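{- Let $c := \frac{4}{9-\sqrt 5}$, $\phi := \frac{1+\sqrt5}{2}$, $\psi := 1-\phi$, and $F_n := \frac{\phi^n - \psi^n}{\sqrt 5}$ for integers $n \geq 0$. Define $\widetilde{y}_1 := c$, $\widetilde{y}_2 := \frac{c}{2}$, $\widetilde{y}_3 := \frac{5c-2}{2}$, and for natural $n \geq 4$, $\widetilde{y}_n := \frac{(3F_n + F_{n-2} - 2)c - 2F_n + 2}{2}$. Then: (1) for all natural $n \geq 4$, $2\widetilde{y}_{n+1} - 2\widetilde{y}_n = (4c-2)F_{n-1} - cF_{n-2}$; (2) for all natural $n \geq 4$, $2\widetilde{y}_{n+1} = 2\widetilde{y}_n - c\psi^{n-1} = 2\widetilde{y}_n + c(-1)^n\phi^{1-n}$; (3) the sequence $(\widetilde{y}_{2k})_{k \in \mathbb{N}}$ is strictly increasing; (4) the sequence $(\widetilde{y}_{2k+1})_{k \in \mathbb{N}}$ is strictly decreasing; (5) for all natural $k$ and $n$, $\widetilde{y}_{2n+1} > \widetilde{y}_{2k}$; (6) for all natural $n$, $\widetilde{y}_n + 2\widetilde{y}_{n+1} < 1 + \frac{c}{2}$; (7) for all natural $n$, $1 - \widetilde{y}_n - \widetilde{y}_{n+1} = c - \widetilde{y}_{n+2}$.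
   Context: Natural numbers are $1,2,3,\dots$. $F_n$ is the $n$-th Fibonacci number (with $F_0=0$, $F_1=1$). -}

module Defs where

open import Data.Nat as ℕ using (ℕ; zero; suc; _∸_)
open import Data.Rational as ℚ using (ℚ; 0ℚ; 1ℚ; ½)
open import Data.Rational.Properties as ℚP using ()
open import Data.Product using (_×_; _,_)
open import Data.Sum using (_⊎_)
open import Relation.Binary.PropositionalEquality using (_≡_)
open import Relation.Nullary using (¬_; yes; no)

-- The real quadratic field ℚ(√5) ⊂ ℝ: a pair (a , b) stands for the real number a + b√5.
-- Since ℚ is normalised and √5 is irrational, the representation is unique, so
-- propositional equality ≡ on pairs is equality of the real numbers.
record Q5 : Set where
  constructor _+√5·_
  field
    re : ℚ
    ir : ℚ
open Q5 public

infixl 6 _⊕_ _⊖_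
infixl 7 _⊗_

fromℚ : ℚ → Q5
fromℚ q = q +√5· 0ℚ

𝟘 𝟙 𝟚 √5 : Q5
𝟘 = fromℚ 0ℚ
𝟙 = fromℚ 1ℚ
𝟚 = fromℚ (1ℚ ℚ.+ 1ℚ)
√5 = 0ℚ +√5· 1ℚ

five : ℚ
five = 1ℚ ℚ.+ 1ℚ ℚ.+ 1ℚ ℚ.+ 1ℚ ℚ.+ 1ℚ

_⊕_ : Q5 → Q5 → Q5
(a +√5· b) ⊕ (c +√5· d) = (a ℚ.+ c) +√5· (b ℚ.+ d)

⊝_ : Q5 → Q5
⊝ (a +√5· b) = (ℚ.- a) +√5· (ℚ.- b)

_⊖_ : Q5 → Q5 → Q5
x ⊖ y = x ⊕ (⊝ y)

_⊗_ : Q5 → Q5 → Q5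
(a +√5· b) ⊗ (c +√5· d) = (a ℚ.* c ℚ.+ five ℚ.* (b ℚ.* d)) +√5· (a ℚ.* d ℚ.+ b ℚ.* c)

-- multiplicative inverse: 1/(a + b√5) = (a - b√5)/(a² - 5b²); (inverse of 0 is set to 0)
inv : Q5 → Q5
inv (a +√5· b) with (a ℚ.* a ℚ.- five ℚ.* (b ℚ.* b)) ℚP.≟ 0ℚ
... | yes _ = 𝟘
... | no N≢0 = (a ℚ.* r) +√5· ((ℚ.- b) ℚ.* r)
  where
    N = a ℚ.* a ℚ.- five ℚ.* (b ℚ.* b)
    r = ℚ.1/_ N {{ℚ.≢-nonZero N≢0}}

_⊘_ : Q5 → Q5 → Q5
x ⊘ y = x ⊗ inv y

infixr 8 _^_
_^_ : Q5 → ℕ → Q5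
x ^ zero = 𝟙
x ^ suc n = x ⊗ (x ^ n)

-- order inherited from ℝ: a + b√5 > 0
Pos : Q5 → Set
Pos (a +√5· b) =
    (0ℚ ℚ.≤ a × 0ℚ ℚ.≤ b × ¬ (a ≡ 0ℚ × b ≡ 0ℚ))
  ⊎ (0ℚ ℚ.< a × b ℚ.< 0ℚ × five ℚ.* (b ℚ.* b) ℚ.< a ℚ.* a)
  ⊎ (a ℚ.< 0ℚ × 0ℚ ℚ.< b × a ℚ.* a ℚ.< five ℚ.* (b ℚ.* b))

infix 4 _≺_
_≺_ : Q5 → Q5 → Set
x ≺ y = Pos (y ⊖ x)

c φ ψ : Q5
c = fromℚ (five ℚ.- 1ℚ) ⊘ (fromℚ (five ℚ.+ five ℚ.- 1ℚ) ⊖ √5)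
φ = (𝟙 ⊕ √5) ⊘ 𝟚
ψ = 𝟙 ⊖ φ

F : ℕ → Q5
F n = ((φ ^ n) ⊖ (ψ ^ n)) ⊘ √5

-- ỹ_n for n ≥ 1 (ỹ_0 is an unused junk value 0)
ỹ : ℕ → Q5
ỹ 0 = 𝟘
ỹ 1 = c
ỹ 2 = c ⊘ 𝟚
ỹ 3 = (fromℚ five ⊗ c ⊖ 𝟚) ⊘ 𝟚
ỹ n@(suc (suc (suc (suc _)))) =
  ((fromℚ (1ℚ ℚ.+ 1ℚ ℚ.+ 1ℚ) ⊗ F n ⊕ F (n ∸ 2) ⊖ 𝟚) ⊗ c ⊖ 𝟚 ⊗ F n ⊕ 𝟚) ⊘ 𝟚

-- Binet's formula and the choice of c collapse the definition to ỹ (m + 1) = A + B ψᵐ with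
-- A = 1 - c and B = c / 2φ, so (1), (2) and (7) are identities in ℚ(√5), and (3)–(6) are sign
-- statements about B, ψ², -ψ and a few constants combined with powers of ψ². Signs are decided
-- inside ℚ(√5) through the norm: positivity is closed under products because N is
-- multiplicative, and under sums because multiplying by ± the conjugate reduces a sum to a
-- positive rational plus a positive number, where the irrationality of √5 rules out a
-- vanishing norm.
module Submission where

open import Defs
open import Level using (0ℓ)
open import Function using (id; _∘_)
open import Data.Empty using (⊥-elim)
open import Data.List using (_∷_; [])
open import Data.Product using (_×_; _,_; ∃₂)
open import Data.Sum using (inj₁; inj₂; [_,_]′)
open import Data.Nat as ℕ using (ℕ; zero; suc; _∸_; _*_; _+_; _≥_; s≤s; z≤n)
import Data.Nat.Properties as ℕ
open import Data.Nat.Divisibility using (_∣_; divides)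
open import Data.Nat.Primality using (prime?; euclidsLemma)
open import Data.Nat.Induction using (<-wellFounded)
import Data.Nat.Tactic.RingSolver as ℕ-Solver
open import Data.Integer as ℤ using (+_)
import Data.Integer.Properties as ℤ
open import Data.Rational as ℚ using (ℚ; mkℚ; 0ℚ; 1ℚ)
import Data.Rational.Properties as ℚ
import Data.Rational.Unnormalised as ℚᵘ
import Data.Rational.Unnormalised.Properties as ℚᵘ
import Data.Rational.Solver
open import Induction.WellFounded using (Acc; acc)
open import Algebra.Bundles using (CommutativeRing)
import Algebra.Solver.Ring.AlmostCommutativeRing as ACR
import Algebra.Solver.Ring.Simple as SimpleSolver
open import Relation.Binary.Definitions using (DecidableEquality; tri<; tri≈; tri>)
open import Relation.Binary.PropositionalEquality
open import Algebra.Structures {A = Q5} _≡_ using (IsCommutativeRing)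
open import Relation.Nullary using (Dec; yes; no)
open import Relation.Nullary.Decidable using (map′; _×-dec_; _⊎-dec_; from-yes)

module ℚ-Solver = Data.Rational.Solver.+-*-Solver

⊕-assoc : ∀ x y z → (x ⊕ y) ⊕ z ≡ x ⊕ (y ⊕ z)
⊕-assoc (a +√5· b) (c +√5· d) (e +√5· f) = cong₂ _+√5·_ (ℚ.+-assoc a c e) (ℚ.+-assoc b d f)

⊕-comm : ∀ x y → x ⊕ y ≡ y ⊕ x
⊕-comm (a +√5· b) (c +√5· d) = cong₂ _+√5·_ (ℚ.+-comm a c) (ℚ.+-comm b d)

⊕-identityˡ : ∀ x → 𝟘 ⊕ x ≡ x
⊕-identityˡ (a +√5· b) = cong₂ _+√5·_ (ℚ.+-identityˡ a) (ℚ.+-identityˡ b)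

⊕-identityʳ : ∀ x → x ⊕ 𝟘 ≡ x
⊕-identityʳ (a +√5· b) = cong₂ _+√5·_ (ℚ.+-identityʳ a) (ℚ.+-identityʳ b)

⊕-inverseˡ : ∀ x → ⊝ x ⊕ x ≡ 𝟘
⊕-inverseˡ (a +√5· b) = cong₂ _+√5·_ (ℚ.+-inverseˡ a) (ℚ.+-inverseˡ b)

⊕-inverseʳ : ∀ x → x ⊕ ⊝ x ≡ 𝟘
⊕-inverseʳ (a +√5· b) = cong₂ _+√5·_ (ℚ.+-inverseʳ a) (ℚ.+-inverseʳ b)

⊗-assoc : ∀ x y z → (x ⊗ y) ⊗ z ≡ x ⊗ (y ⊗ z)
⊗-assoc (a +√5· b) (c +√5· d) (e +√5· f) = cong₂ _+√5·_
  (solve 7 (λ a b c d e f v → (a :* c :+ v :* (b :* d)) :* e :+ v :* ((a :* d :+ b :* c) :* f)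
                           := a :* (c :* e :+ v :* (d :* f)) :+ v :* (b :* (c :* f :+ d :* e)))
         refl a b c d e f five)
  (solve 7 (λ a b c d e f v → (a :* c :+ v :* (b :* d)) :* f :+ (a :* d :+ b :* c) :* e
                           := a :* (c :* f :+ d :* e) :+ b :* (c :* e :+ v :* (d :* f)))
         refl a b c d e f five)
  where open ℚ-Solver

⊗-comm : ∀ x y → x ⊗ y ≡ y ⊗ x
⊗-comm (a +√5· b) (c +√5· d) = cong₂ _+√5·_
  (solve 5 (λ a b c d v → a :* c :+ v :* (b :* d) := c :* a :+ v :* (d :* b)) refl a b c d five)
  (solve 4 (λ a b c d → a :* d :+ b :* c := c :* b :+ d :* a) refl a b c d)
  where open ℚ-Solver

⊗-identityˡ : ∀ x → 𝟙 ⊗ x ≡ x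
⊗-identityˡ (a +√5· b) = cong₂ _+√5·_
  (solve 3 (λ a b v → con 1ℚ :* a :+ v :* (con 0ℚ :* b) := a) refl a b five)
  (solve 2 (λ a b → con 1ℚ :* b :+ con 0ℚ :* a := b) refl a b)
  where open ℚ-Solver

⊗-identityʳ : ∀ x → x ⊗ 𝟙 ≡ x
⊗-identityʳ x = trans (⊗-comm x 𝟙) (⊗-identityˡ x)

⊗-distribʳ-⊕ : ∀ x y z → (y ⊕ z) ⊗ x ≡ y ⊗ x ⊕ z ⊗ x
⊗-distribʳ-⊕ (a +√5· b) (c +√5· d) (e +√5· f) = cong₂ _+√5·_
  (solve 7 (λ a b c d e f v → (c :+ e) :* a :+ v :* ((d :+ f) :* b)
                           := (c :* a :+ v :* (d :* b)) :+ (e :* a :+ v :* (f :* b)))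
         refl a b c d e f five)
  (solve 6 (λ a b c d e f → (c :+ e) :* b :+ (d :+ f) :* a := (c :* b :+ d :* a) :+ (e :* b :+ f :* a))
         refl a b c d e f)
  where open ℚ-Solver

⊗-distribˡ-⊕ : ∀ x y z → x ⊗ (y ⊕ z) ≡ x ⊗ y ⊕ x ⊗ z
⊗-distribˡ-⊕ x y z = begin
  x ⊗ (y ⊕ z)    ≡⟨ ⊗-comm x (y ⊕ z) ⟩
  (y ⊕ z) ⊗ x    ≡⟨ ⊗-distribʳ-⊕ x y z ⟩
  y ⊗ x ⊕ z ⊗ x  ≡⟨ cong₂ _⊕_ (⊗-comm y x) (⊗-comm z x) ⟩
  x ⊗ y ⊕ x ⊗ z  ∎
  where open ≡-Reasoning

Q5-isCommutativeRing : IsCommutativeRing _⊕_ _⊗_ ⊝_ 𝟘 𝟙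
Q5-isCommutativeRing = record
  { isRing = record
    { +-isAbelianGroup = record
      { isGroup = record
        { isMonoid = record
          { isSemigroup = record
            { isMagma = record { isEquivalence = isEquivalence ; ∙-cong = cong₂ _⊕_ }
            ; assoc = ⊕-assoc }
          ; identity = ⊕-identityˡ , ⊕-identityʳ }
        ; inverse = ⊕-inverseˡ , ⊕-inverseʳ
        ; ⁻¹-cong = cong ⊝_ }
      ; comm = ⊕-comm }
    ; *-cong = cong₂ _⊗_
    ; *-assoc = ⊗-assoc
    ; *-identity = ⊗-identityˡ , ⊗-identityʳ
    ; distrib = ⊗-distribˡ-⊕ , ⊗-distribʳ-⊕ }
  ; *-comm = ⊗-comm }

Q5-commutativeRing : CommutativeRing 0ℓ 0ℓ
Q5-commutativeRing = record { isCommutativeRing = Q5-isCommutativeRing }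

_≟_ : DecidableEquality Q5
(a +√5· b) ≟ (c +√5· d) =
  map′ (λ (p , q) → cong₂ _+√5·_ p q) (λ { refl → refl , refl }) ((a ℚ.≟ c) ×-dec (b ℚ.≟ d))

module Q5-Solver = SimpleSolver (ACR.fromCommutativeRing Q5-commutativeRing) _≟_

module ℚ-Lemmas where
  open ℚ-Solver

  p-q+q≡p : ∀ p q → p ℚ.- q ℚ.+ q ≡ p
  p-q+q≡p = solve 2 (λ p q → p :- q :+ q := p) refl

  neg-involutive : ∀ p → ℚ.- (ℚ.- p) ≡ p
  neg-involutive = solve 1 (λ p → :- (:- p) := p) refl

  p<q⇒0<q-p : ∀ {p q} → p ℚ.< q → 0ℚ ℚ.< q ℚ.- p
  p<q⇒0<q-p {p} {q} p<q = subst (ℚ._< q ℚ.- p) (ℚ.+-inverseʳ p) (ℚ.+-monoˡ-< (ℚ.- p) p<q)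

  0<p-q⇒q<p : ∀ {p q} → 0ℚ ℚ.< p ℚ.- q → q ℚ.< p
  0<p-q⇒q<p {p} {q} 0<p-q = subst₂ ℚ._<_ (ℚ.+-identityˡ q) (p-q+q≡p p q) (ℚ.+-monoˡ-< q 0<p-q)

  p-q<0⇒p<q : ∀ {p q} → p ℚ.- q ℚ.< 0ℚ → p ℚ.< q
  p-q<0⇒p<q {p} {q} p-q<0 = subst₂ ℚ._<_ (p-q+q≡p p q) (ℚ.+-identityˡ q) (ℚ.+-monoˡ-< q p-q<0)

  +-pos : ∀ {p q} → 0ℚ ℚ.< p → 0ℚ ℚ.< q → 0ℚ ℚ.< p ℚ.+ q
  +-pos = ℚ.+-mono-< {0ℚ} {_} {0ℚ}

  +-neg : ∀ {p q} → p ℚ.< 0ℚ → q ℚ.< 0ℚ → p ℚ.+ q ℚ.< 0ℚ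
  +-neg = ℚ.+-mono-< {_} {0ℚ} {_} {0ℚ}

  *-pos : ∀ {p q} → 0ℚ ℚ.< p → 0ℚ ℚ.< q → 0ℚ ℚ.< p ℚ.* q
  *-pos {p} {q} 0<p 0<q = subst (ℚ._< p ℚ.* q) (ℚ.*-zeroʳ p) (ℚ.*-monoʳ-<-pos p {{ℚ.positive 0<p}} 0<q)

  *-pos-neg : ∀ {p q} → 0ℚ ℚ.< p → q ℚ.< 0ℚ → p ℚ.* q ℚ.< 0ℚ
  *-pos-neg {p} {q} 0<p q<0 = subst (p ℚ.* q ℚ.<_) (ℚ.*-zeroʳ p) (ℚ.*-monoʳ-<-pos p {{ℚ.positive 0<p}} q<0)

  *-neg-neg : ∀ {p q} → p ℚ.< 0ℚ → q ℚ.< 0ℚ → 0ℚ ℚ.< p ℚ.* q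
  *-neg-neg {p} {q} p<0 q<0 = subst (ℚ._< p ℚ.* q) (ℚ.*-zeroʳ p) (ℚ.*-monoʳ-<-neg p {{ℚ.negative p<0}} q<0)

  pos-factor : ∀ {p q} → 0ℚ ℚ.< q → 0ℚ ℚ.< p ℚ.* q → 0ℚ ℚ.< p
  pos-factor {p} {q} 0<q 0<pq =
    ℚ.*-cancelʳ-<-nonNeg q {{ℚ.nonNegative (ℚ.<⇒≤ 0<q)}} (subst (ℚ._< p ℚ.* q) (sym (ℚ.*-zeroˡ q)) 0<pq)

  neg-factor : ∀ {p q} → 0ℚ ℚ.< q → p ℚ.* q ℚ.< 0ℚ → p ℚ.< 0ℚ
  neg-factor {p} {q} 0<q pq<0 =
    ℚ.*-cancelʳ-<-nonNeg q {{ℚ.nonNegative (ℚ.<⇒≤ 0<q)}} (subst (p ℚ.* q ℚ.<_) (sym (ℚ.*-zeroˡ q)) pq<0)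

  square-nonNeg : ∀ p → 0ℚ ℚ.≤ p ℚ.* p
  square-nonNeg p with ℚ.<-cmp p 0ℚ
  ... | tri< p<0 _ _ = ℚ.<⇒≤ (*-neg-neg p<0 p<0)
  ... | tri≈ _ refl _ = ℚ.≤-refl
  ... | tri> _ _ 0<p = ℚ.<⇒≤ (*-pos 0<p 0<p)

  *-mono-<-nonNeg : ∀ {p q r s} → 0ℚ ℚ.≤ p → p ℚ.< q → 0ℚ ℚ.≤ r → r ℚ.< s → p ℚ.* r ℚ.< q ℚ.* s
  *-mono-<-nonNeg {p} {q} {r} {s} 0≤p p<q 0≤r r<s = ℚ.≤-<-trans
    (ℚ.*-monoʳ-≤-nonNeg r {{ℚ.nonNegative 0≤r}} (ℚ.<⇒≤ p<q))
    (ℚ.*-monoʳ-<-pos q {{ℚ.positive (ℚ.≤-<-trans 0≤p p<q)}} r<s)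

  -- For y < 0: x + y = (x² - y²) / (x - y), and x - y > 0.
  square-<⇒+-pos : ∀ {x y} → 0ℚ ℚ.< x → y ℚ.* y ℚ.< x ℚ.* x → 0ℚ ℚ.< x ℚ.+ y
  square-<⇒+-pos {x} {y} 0<x y²<x² with ℚ.<-cmp y 0ℚ
  ... | tri< y<0 _ _ = pos-factor 0<x-y (subst (0ℚ ℚ.<_) difference-of-squares (p<q⇒0<q-p y²<x²))
    where
    difference-of-squares : x ℚ.* x ℚ.- y ℚ.* y ≡ (x ℚ.+ y) ℚ.* (x ℚ.- y)
    difference-of-squares = solve 2 (λ x y → x :* x :- y :* y := (x :+ y) :* (x :- y)) refl x y
    0<x-y : 0ℚ ℚ.< x ℚ.- y
    0<x-y = ℚ.+-mono-< 0<x (ℚ.neg-antimono-< y<0)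
  ... | tri≈ _ refl _ = subst (0ℚ ℚ.<_) (sym (ℚ.+-identityʳ x)) 0<x
  ... | tri> _ _ 0<y = +-pos 0<x 0<y

open ℚ-Lemmas

N : Q5 → ℚ
N (a +√5· b) = a ℚ.* a ℚ.- five ℚ.* (b ℚ.* b)

conj : Q5 → Q5
conj (a +√5· b) = a +√5· (ℚ.- b)

N-⊗ : ∀ x y → N (x ⊗ y) ≡ N x ℚ.* N y
N-⊗ (a +√5· b) (c +√5· d) = solve 5 (λ a b c d v →
    (a :* c :+ v :* (b :* d)) :* (a :* c :+ v :* (b :* d)) :- v :* ((a :* d :+ b :* c) :* (a :* d :+ b :* c))
    := (a :* a :- v :* (b :* b)) :* (c :* c :- v :* (d :* d))) refl a b c d five
  where open ℚ-Solver

N-fromℚ : ∀ q → N (fromℚ q) ≡ q ℚ.* q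
N-fromℚ q = solve 2 (λ q v → q :* q :- v :* (con 0ℚ :* con 0ℚ) := q :* q) refl q five
  where open ℚ-Solver

N-fromℚ-⊕ : ∀ q x → N (fromℚ q ⊕ x) ≡ N x ℚ.+ q ℚ.* (q ℚ.+ re x ℚ.+ re x)
N-fromℚ-⊕ q (a +√5· b) = solve 4 (λ q a b v →
    (q :+ a) :* (q :+ a) :- v :* ((con 0ℚ :+ b) :* (con 0ℚ :+ b)) := a :* a :- v :* (b :* b) :+ q :* (q :+ a :+ a))
  refl q a b five
  where open ℚ-Solver

N-conj : ∀ x → N (conj x) ≡ N x
N-conj (a +√5· b) = solve 3 (λ a b v → a :* a :- v :* (:- b :* :- b) := a :* a :- v :* (b :* b)) refl a b five
  where open ℚ-Solver

N-⊝conj : ∀ x → N (⊝ conj x) ≡ N x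
N-⊝conj (a +√5· b) =
  solve 3 (λ a b v → :- a :* :- a :- v :* (:- (:- b) :* :- (:- b)) := a :* a :- v :* (b :* b)) refl a b five
  where open ℚ-Solver

⊗-conj : ∀ x → x ⊗ conj x ≡ fromℚ (N x)
⊗-conj (a +√5· b) = cong₂ _+√5·_
  (solve 3 (λ a b v → a :* a :+ v :* (b :* :- b) := a :* a :- v :* (b :* b)) refl a b five)
  (solve 2 (λ a b → a :* :- b :+ b :* a := con 0ℚ) refl a b)
  where open ℚ-Solver

⊗-⊝conj : ∀ x → x ⊗ ⊝ conj x ≡ fromℚ (ℚ.- N x)
⊗-⊝conj (a +√5· b) = cong₂ _+√5·_
  (solve 3 (λ a b v → a :* :- a :+ v :* (b :* :- (:- b)) := :- (a :* a :- v :* (b :* b))) refl a b five)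
  (solve 2 (λ a b → a :* :- (:- b) :+ b :* :- a := con 0ℚ) refl a b)
  where open ℚ-Solver

⊗-fromℚ : ∀ x q → x ⊗ fromℚ q ≡ (re x ℚ.* q) +√5· (ir x ℚ.* q)
⊗-fromℚ (a +√5· b) q = cong₂ _+√5·_
  (solve 4 (λ a b q v → a :* q :+ v :* (b :* con 0ℚ) := a :* q) refl a b q five)
  (solve 3 (λ a b q → a :* con 0ℚ :+ b :* q := b :* q) refl a b q)
  where open ℚ-Solver

5∣m²⇒5∣m : ∀ m → 5 ∣ m ℕ.* m → 5 ∣ m
5∣m²⇒5∣m m 5∣m² = [ id , id ]′ (euclidsLemma m m (from-yes (prime? 5)) 5∣m²)

m²≡n²*5⇒n≡0 : ∀ m n → m ℕ.* m ≡ n ℕ.* n ℕ.* 5 → n ≡ 0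
m²≡n²*5⇒n≡0 m n = descent n (<-wellFounded n) m
  where
  [k*5]²≡n²*5⇒n²≡k²*5 : ∀ k n → k ℕ.* 5 ℕ.* (k ℕ.* 5) ≡ n ℕ.* n ℕ.* 5 → n ℕ.* n ≡ k ℕ.* k ℕ.* 5
  [k*5]²≡n²*5⇒n²≡k²*5 k n eq = ℕ.*-cancelʳ-≡ _ _ 5 (trans (sym eq) (ℕ-Solver.solve (k ∷ [])))

  descent : ∀ n → Acc ℕ._<_ n → ∀ m → m ℕ.* m ≡ n ℕ.* n ℕ.* 5 → n ≡ 0
  descent n (acc rec) m m²≡n²*5 with 5∣m²⇒5∣m m (divides (n ℕ.* n) m²≡n²*5)
  ... | divides k refl with 5∣m²⇒5∣m n (divides (k ℕ.* k) ([k*5]²≡n²*5⇒n²≡k²*5 k n m²≡n²*5))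
  ...   | divides zero refl = refl
  ...   | divides l@(suc _) refl = cong (ℕ._* 5) (descent l (rec (ℕ.m<m*n l 5 (s≤s (s≤s z≤n)))) k
            ([k*5]²≡n²*5⇒n²≡k²*5 l k ([k*5]²≡n²*5⇒n²≡k²*5 k (l ℕ.* 5) m²≡n²*5)))

-- Clearing denominators turns a² = 5b² into the equation m² = 5n² of the descent above.
√5-irrational : ∀ a b → a ℚ.* a ≡ five ℚ.* (b ℚ.* b) → b ≡ 0ℚ
√5-irrational a@(mkℚ p d-1 _) b@(mkℚ r e-1 _) a²≡5b² =
  ℚ.↥p≡0⇒p≡0 b (ℤ.∣i∣≡0⇒i≡0 (ℕ.m*n≡0⇒m≡0 ℤ.∣ r ∣ D (m²≡n²*5⇒n≡0 (ℤ.∣ p ∣ ℕ.* E) _ ℕ-eq)))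
  where
  D E : ℕ
  D = suc d-1
  E = suc e-1

  ℚᵘ-eq : ℚᵘ._≃_ (ℚ.toℚᵘ a ℚᵘ.* ℚ.toℚᵘ a) (ℚ.toℚᵘ five ℚᵘ.* (ℚ.toℚᵘ b ℚᵘ.* ℚ.toℚᵘ b))
  ℚᵘ-eq = ℚᵘ.≃-trans (ℚᵘ.≃-sym (ℚ.toℚᵘ-homo-* a a))
            (ℚᵘ.≃-trans (ℚᵘ.≃-reflexive (cong ℚ.toℚᵘ a²≡5b²))
              (ℚᵘ.≃-trans (ℚ.toℚᵘ-homo-* five (b ℚ.* b)) (ℚᵘ.*-congˡ {ℚ.toℚᵘ five} (ℚ.toℚᵘ-homo-* b b))))

  ℤ-eq : p ℤ.* p ℤ.* + (1 ℕ.* (E ℕ.* E)) ≡ + 5 ℤ.* (r ℤ.* r) ℤ.* + (D ℕ.* D)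
  ℤ-eq with ℚᵘ-eq
  ... | ℚᵘ.*≡* eq = eq

  ℕ-eq : ℤ.∣ p ∣ ℕ.* E ℕ.* (ℤ.∣ p ∣ ℕ.* E) ≡ ℤ.∣ r ∣ ℕ.* D ℕ.* (ℤ.∣ r ∣ ℕ.* D) ℕ.* 5
  ℕ-eq = begin
    ℤ.∣ p ∣ ℕ.* E ℕ.* (ℤ.∣ p ∣ ℕ.* E)          ≡⟨ lhs-shape ℤ.∣ p ∣ E ⟩
    ℤ.∣ p ∣ ℕ.* ℤ.∣ p ∣ ℕ.* (1 ℕ.* (E ℕ.* E))  ≡⟨ cong (ℕ._* _) (ℤ.abs-* p p) ⟨
    ℤ.∣ p ℤ.* p ∣ ℕ.* (1 ℕ.* (E ℕ.* E))        ≡⟨ ℤ.abs-* (p ℤ.* p) _ ⟨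
    ℤ.∣ p ℤ.* p ℤ.* + (1 ℕ.* (E ℕ.* E)) ∣      ≡⟨ cong ℤ.∣_∣ ℤ-eq ⟩
    ℤ.∣ + 5 ℤ.* (r ℤ.* r) ℤ.* + (D ℕ.* D) ∣    ≡⟨ ℤ.abs-* (+ 5 ℤ.* (r ℤ.* r)) _ ⟩
    ℤ.∣ + 5 ℤ.* (r ℤ.* r) ∣ ℕ.* (D ℕ.* D)      ≡⟨ cong (ℕ._* _) (ℤ.abs-* (+ 5) (r ℤ.* r)) ⟩
    5 ℕ.* ℤ.∣ r ℤ.* r ∣ ℕ.* (D ℕ.* D)          ≡⟨ cong (λ x → 5 ℕ.* x ℕ.* _) (ℤ.abs-* r r) ⟩
    5 ℕ.* (ℤ.∣ r ∣ ℕ.* ℤ.∣ r ∣) ℕ.* (D ℕ.* D)  ≡⟨ rhs-shape ℤ.∣ r ∣ D ⟩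
    ℤ.∣ r ∣ ℕ.* D ℕ.* (ℤ.∣ r ∣ ℕ.* D) ℕ.* 5    ∎
    where
    open ≡-Reasoning
    lhs-shape : ∀ x y → x ℕ.* y ℕ.* (x ℕ.* y) ≡ x ℕ.* x ℕ.* (1 ℕ.* (y ℕ.* y))
    lhs-shape = ℕ-Solver.solve-∀
    rhs-shape : ∀ x y → 5 ℕ.* (x ℕ.* x) ℕ.* (y ℕ.* y) ≡ x ℕ.* y ℕ.* (x ℕ.* y) ℕ.* 5
    rhs-shape = ℕ-Solver.solve-∀

N≡0⇒ir≡0 : ∀ x → N x ≡ 0ℚ → ir x ≡ 0ℚ
N≡0⇒ir≡0 (a +√5· b) N≡0 = √5-irrational a b (begin
  a ℚ.* a                              ≡⟨ p-q+q≡p (a ℚ.* a) (five ℚ.* (b ℚ.* b)) ⟨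
  N (a +√5· b) ℚ.+ five ℚ.* (b ℚ.* b)  ≡⟨ cong (ℚ._+ five ℚ.* (b ℚ.* b)) N≡0 ⟩
  0ℚ ℚ.+ five ℚ.* (b ℚ.* b)            ≡⟨ ℚ.+-identityˡ _ ⟩
  five ℚ.* (b ℚ.* b)                   ∎)
  where open ≡-Reasoning

-- x > 0 iff either both conjugates x, x̄ are positive (N x > 0 and re x > 0), or x > 0 > x̄ (N x < 0 and ir x > 0).
data Positive (x : Q5) : Set where
  totally  : 0ℚ ℚ.< N x → 0ℚ ℚ.< re x → Positive x
  conj-neg : N x ℚ.< 0ℚ → 0ℚ ℚ.< ir x → Positive x

private
  variable
    x y : Q5

positive? : ∀ x → Dec (Positive x)
positive? x = map′ [ (λ (p , q) → totally p q) , (λ (p , q) → conj-neg p q) ]′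
  (λ { (totally p q) → inj₁ (p , q) ; (conj-neg p q) → inj₂ (p , q) })
  (((0ℚ ℚ.<? N x) ×-dec (0ℚ ℚ.<? re x)) ⊎-dec ((N x ℚ.<? 0ℚ) ×-dec (0ℚ ℚ.<? ir x)))

0<N⇒5b²<a² : 0ℚ ℚ.< N x → five ℚ.* (ir x ℚ.* ir x) ℚ.< re x ℚ.* re x
0<N⇒5b²<a² {x} = 0<p-q⇒q<p {re x ℚ.* re x} {five ℚ.* (ir x ℚ.* ir x)}

N<0⇒a²<5b² : N x ℚ.< 0ℚ → re x ℚ.* re x ℚ.< five ℚ.* (ir x ℚ.* ir x)
N<0⇒a²<5b² {x} = p-q<0⇒p<q {re x ℚ.* re x} {five ℚ.* (ir x ℚ.* ir x)}

Positive⇒Pos : Positive x → Pos x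
Positive⇒Pos {x@(a +√5· b)} (totally 0<N 0<a) with 0ℚ ℚ.≤? b
... | yes 0≤b = inj₁ (ℚ.<⇒≤ 0<a , 0≤b , λ (a≡0 , _) → ℚ.<-irrefl (sym a≡0) 0<a)
... | no 0≰b  = inj₂ (inj₁ (0<a , ℚ.≰⇒> 0≰b , 0<N⇒5b²<a² {x} 0<N))
Positive⇒Pos {x@(a +√5· b)} (conj-neg N<0 0<b) with 0ℚ ℚ.≤? a
... | yes 0≤a = inj₁ (0≤a , ℚ.<⇒≤ 0<b , λ (_ , b≡0) → ℚ.<-irrefl (sym b≡0) 0<b)
... | no 0≰a  = inj₂ (inj₂ (ℚ.≰⇒> 0≰a , 0<b , N<0⇒a²<5b² {x} N<0))

0<five : 0ℚ ℚ.< five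
0<five = from-yes (0ℚ ℚ.<? five)

0≤five*square : ∀ p → 0ℚ ℚ.≤ five ℚ.* (p ℚ.* p)
0≤five*square p = subst (ℚ._≤ five ℚ.* (p ℚ.* p)) (ℚ.*-zeroʳ five)
  (ℚ.*-monoˡ-≤-nonNeg five {{ℚ.nonNegative (ℚ.<⇒≤ 0<five)}} (square-nonNeg p))

totally⊗conj-neg⇒pos : 0ℚ ℚ.< N x → 0ℚ ℚ.< re x → N y ℚ.< 0ℚ → 0ℚ ℚ.< ir y → Positive (x ⊗ y)
totally⊗conj-neg⇒pos {x@(a +√5· b)} {y@(c +√5· d)} 0<Nx 0<a Ny<0 0<d =
  conj-neg (subst (ℚ._< 0ℚ) (sym (N-⊗ x y)) (*-pos-neg 0<Nx Ny<0))
           (square-<⇒+-pos (*-pos 0<a 0<d) [bc]²<[ad]²)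
  where
  open ℚ.≤-Reasoning
  open ℚ-Solver
  [bc]²<[ad]² : b ℚ.* c ℚ.* (b ℚ.* c) ℚ.< a ℚ.* d ℚ.* (a ℚ.* d)
  [bc]²<[ad]² = ℚ.*-cancelˡ-<-nonNeg five {{ℚ.nonNegative (ℚ.<⇒≤ 0<five)}} (begin-strict
    five ℚ.* (b ℚ.* c ℚ.* (b ℚ.* c))
      ≡⟨ solve 3 (λ b c v → v :* (b :* c :* (b :* c)) := v :* (b :* b) :* (c :* c)) refl b c five ⟩
    five ℚ.* (b ℚ.* b) ℚ.* (c ℚ.* c)
      <⟨ *-mono-<-nonNeg (0≤five*square b) (0<N⇒5b²<a² {x} 0<Nx) (square-nonNeg c) (N<0⇒a²<5b² {y} Ny<0) ⟩
    a ℚ.* a ℚ.* (five ℚ.* (d ℚ.* d))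
      ≡⟨ solve 3 (λ a d v → a :* a :* (v :* (d :* d)) := v :* (a :* d :* (a :* d))) refl a d five ⟩
    five ℚ.* (a ℚ.* d ℚ.* (a ℚ.* d))  ∎)

pos⊗pos⇒pos : Positive x → Positive y → Positive (x ⊗ y)
pos⊗pos⇒pos {x@(a +√5· b)} {y@(c +√5· d)} (totally 0<Nx 0<a) (totally 0<Ny 0<c) =
  totally (subst (0ℚ ℚ.<_) (sym (N-⊗ x y)) (*-pos 0<Nx 0<Ny))
          (square-<⇒+-pos (*-pos 0<a 0<c) [5bd]²<[ac]²)
  where
  open ℚ.≤-Reasoning
  open ℚ-Solver
  [5bd]²<[ac]² : five ℚ.* (b ℚ.* d) ℚ.* (five ℚ.* (b ℚ.* d)) ℚ.< a ℚ.* c ℚ.* (a ℚ.* c)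
  [5bd]²<[ac]² = begin-strict
    five ℚ.* (b ℚ.* d) ℚ.* (five ℚ.* (b ℚ.* d))
      ≡⟨ solve 3 (λ b d v → v :* (b :* d) :* (v :* (b :* d)) := v :* (b :* b) :* (v :* (d :* d))) refl b d five ⟩
    five ℚ.* (b ℚ.* b) ℚ.* (five ℚ.* (d ℚ.* d))
      <⟨ *-mono-<-nonNeg (0≤five*square b) (0<N⇒5b²<a² {x} 0<Nx) (0≤five*square d) (0<N⇒5b²<a² {y} 0<Ny) ⟩
    a ℚ.* a ℚ.* (c ℚ.* c)
      ≡⟨ solve 2 (λ a c → a :* a :* (c :* c) := a :* c :* (a :* c)) refl a c ⟩
    a ℚ.* c ℚ.* (a ℚ.* c)  ∎
pos⊗pos⇒pos {x} {y} (totally 0<Nx 0<a) (conj-neg Ny<0 0<d) = totally⊗conj-neg⇒pos {x} {y} 0<Nx 0<a Ny<0 0<d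
pos⊗pos⇒pos {x} {y} (conj-neg Nx<0 0<b) (totally 0<Ny 0<c) =
  subst Positive (⊗-comm y x) (totally⊗conj-neg⇒pos {y} {x} 0<Ny 0<c Nx<0 0<b)
pos⊗pos⇒pos {x@(a +√5· b)} {y@(c +√5· d)} (conj-neg Nx<0 0<b) (conj-neg Ny<0 0<d) =
  totally (subst (0ℚ ℚ.<_) (sym (N-⊗ x y)) (*-neg-neg Nx<0 Ny<0))
          (subst (0ℚ ℚ.<_) (ℚ.+-comm (five ℚ.* (b ℚ.* d)) (a ℚ.* c))
            (square-<⇒+-pos (*-pos 0<five (*-pos 0<b 0<d)) [ac]²<[5bd]²))
  where
  open ℚ.≤-Reasoning
  open ℚ-Solver
  [ac]²<[5bd]² : a ℚ.* c ℚ.* (a ℚ.* c) ℚ.< five ℚ.* (b ℚ.* d) ℚ.* (five ℚ.* (b ℚ.* d))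
  [ac]²<[5bd]² = begin-strict
    a ℚ.* c ℚ.* (a ℚ.* c)
      ≡⟨ solve 2 (λ a c → a :* c :* (a :* c) := a :* a :* (c :* c)) refl a c ⟩
    a ℚ.* a ℚ.* (c ℚ.* c)
      <⟨ *-mono-<-nonNeg (square-nonNeg a) (N<0⇒a²<5b² {x} Nx<0) (square-nonNeg c) (N<0⇒a²<5b² {y} Ny<0) ⟩
    five ℚ.* (b ℚ.* b) ℚ.* (five ℚ.* (d ℚ.* d))
      ≡⟨ solve 3 (λ b d v → v :* (b :* b) :* (v :* (d :* d)) := v :* (b :* d) :* (v :* (b :* d))) refl b d five ⟩
    five ℚ.* (b ℚ.* d) ℚ.* (five ℚ.* (b ℚ.* d))  ∎

N-⊗fromℚ : ∀ x q → N (x ⊗ fromℚ q) ≡ N x ℚ.* (q ℚ.* q)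
N-⊗fromℚ x q = trans (N-⊗ x (fromℚ q)) (cong (N x ℚ.*_) (N-fromℚ q))

pos⊗ℚ⇒pos : ∀ {q} → 0ℚ ℚ.< q → Positive (x ⊗ fromℚ q) → Positive x
pos⊗ℚ⇒pos {x} {q} 0<q (totally 0<N 0<re) =
  totally (pos-factor (*-pos 0<q 0<q) (subst (0ℚ ℚ.<_) (N-⊗fromℚ x q) 0<N))
          (pos-factor 0<q (subst (0ℚ ℚ.<_) (cong re (⊗-fromℚ x q)) 0<re))
pos⊗ℚ⇒pos {x} {q} 0<q (conj-neg N<0 0<ir) =
  conj-neg (neg-factor (*-pos 0<q 0<q) (subst (ℚ._< 0ℚ) (N-⊗fromℚ x q) N<0))
           (pos-factor 0<q (subst (0ℚ ℚ.<_) (cong ir (⊗-fromℚ x q)) 0<ir))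

-- If q + a ≤ 0 then a < 0 and N (q + x) = N x + q (q + 2a) < N x.
N<0⇒0<N[q⊕x]⇒0<q+a : ∀ {q} → 0ℚ ℚ.< q → N x ℚ.< 0ℚ → 0ℚ ℚ.< N (fromℚ q ⊕ x) → 0ℚ ℚ.< q ℚ.+ re x
N<0⇒0<N[q⊕x]⇒0<q+a {x} {q} 0<q N<0 0<N′ with 0ℚ ℚ.<? q ℚ.+ re x
... | yes 0<q+a = 0<q+a
... | no 0≮q+a  = ⊥-elim (ℚ.<-asym 0<N′ N′<0)
  where
  q+a≤0 = ℚ.≮⇒≥ 0≮q+a
  a<0 : re x ℚ.< 0ℚ
  a<0 = ℚ.<-≤-trans (subst (ℚ._< q ℚ.+ re x) (ℚ.+-identityˡ (re x)) (ℚ.+-monoˡ-< (re x) 0<q)) q+a≤0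
  N′<0 : N (fromℚ q ⊕ x) ℚ.< 0ℚ
  N′<0 = subst (ℚ._< 0ℚ) (sym (N-fromℚ-⊕ q x))
    (+-neg N<0 (*-pos-neg 0<q (subst (q ℚ.+ re x ℚ.+ re x ℚ.<_) (ℚ.+-identityˡ 0ℚ) (ℚ.+-mono-≤-< q+a≤0 a<0))))

ℚ⊕pos⇒pos : ∀ {q} → 0ℚ ℚ.< q → Positive x → Positive (fromℚ q ⊕ x)
ℚ⊕pos⇒pos {x} {q} 0<q (totally 0<N 0<a) =
  totally (subst (0ℚ ℚ.<_) (sym (N-fromℚ-⊕ q x)) (+-pos 0<N (*-pos 0<q (+-pos (+-pos 0<q 0<a) 0<a))))
          (+-pos 0<q 0<a)
ℚ⊕pos⇒pos {x} {q} 0<q (conj-neg N<0 0<b) with ℚ.<-cmp (N (fromℚ q ⊕ x)) 0ℚ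
... | tri< N′<0 _ _ = conj-neg N′<0 (subst (0ℚ ℚ.<_) (sym (ℚ.+-identityˡ (ir x))) 0<b)
... | tri≈ _ N′≡0 _ = ⊥-elim (ℚ.<-irrefl (sym ir≡0) 0<b)
  where ir≡0 = trans (sym (ℚ.+-identityˡ (ir x))) (N≡0⇒ir≡0 (fromℚ q ⊕ x) N′≡0)
... | tri> _ _ 0<N′ = totally 0<N′ (N<0⇒0<N[q⊕x]⇒0<q+a {x} 0<q N<0 0<N′)

pos⇒rational-multiple : Positive x → ∃₂ λ x′ q → Positive x′ × 0ℚ ℚ.< q × x ⊗ x′ ≡ fromℚ q
pos⇒rational-multiple {x} (totally 0<N 0<a) =
  conj x , N x , totally (subst (0ℚ ℚ.<_) (sym (N-conj x)) 0<N) 0<a , 0<N , ⊗-conj x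
pos⇒rational-multiple {x} (conj-neg N<0 0<b) =
  ⊝ conj x , ℚ.- N x ,
  conj-neg (subst (ℚ._< 0ℚ) (sym (N-⊝conj x)) N<0) (subst (0ℚ ℚ.<_) (sym (neg-involutive (ir x))) 0<b) ,
  ℚ.neg-antimono-< N<0 , ⊗-⊝conj x

-- With x x′ = q: (x + y) q = (q + y x′) x, and the right-hand side is positive.
pos⊕pos⇒pos : Positive x → Positive y → Positive (x ⊕ y)
pos⊕pos⇒pos {x} {y} px py with pos⇒rational-multiple px
... | x′ , q , px′ , 0<q , xx′≡q =
  pos⊗ℚ⇒pos 0<q (subst Positive (sym eq) (pos⊗pos⇒pos (ℚ⊕pos⇒pos 0<q (pos⊗pos⇒pos py px′)) px))
  where
  open ≡-Reasoning
  open Q5-Solver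
  eq : (x ⊕ y) ⊗ fromℚ q ≡ (fromℚ q ⊕ y ⊗ x′) ⊗ x
  eq = begin
    (x ⊕ y) ⊗ fromℚ q       ≡⟨ cong ((x ⊕ y) ⊗_) xx′≡q ⟨
    (x ⊕ y) ⊗ (x ⊗ x′)      ≡⟨ solve 3 (λ x y x′ → (x :+ y) :* (x :* x′) := (x :* x′ :+ y :* x′) :* x) refl x y x′ ⟩
    (x ⊗ x′ ⊕ y ⊗ x′) ⊗ x   ≡⟨ cong (λ w → (w ⊕ y ⊗ x′) ⊗ x) xx′≡q ⟩
    (fromℚ q ⊕ y ⊗ x′) ⊗ x  ∎

pos^n : Positive x → ∀ n → Positive (x ^ n)
pos^n px zero    = from-yes (positive? 𝟙)
pos^n px (suc n) = pos⊗pos⇒pos px (pos^n px n)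

^-double : ∀ x n → x ^ (2 * n) ≡ (x ⊗ x) ^ n
^-double x zero    = refl
^-double x (suc n) = begin
  x ^ (2 * suc n)        ≡⟨ cong (x ^_) (ℕ.*-suc 2 n) ⟩
  x ⊗ (x ⊗ x ^ (2 * n))  ≡⟨ ⊗-assoc x x (x ^ (2 * n)) ⟨
  (x ⊗ x) ⊗ x ^ (2 * n)  ≡⟨ cong ((x ⊗ x) ⊗_) (^-double x n) ⟩
  (x ⊗ x) ^ suc n        ∎
  where open ≡-Reasoning

^-distribʳ-⊗ : ∀ x y n → (x ⊗ y) ^ n ≡ x ^ n ⊗ y ^ n
^-distribʳ-⊗ x y zero    = refl
^-distribʳ-⊗ x y (suc n) = begin
  (x ⊗ y) ⊗ (x ⊗ y) ^ n      ≡⟨ cong ((x ⊗ y) ⊗_) (^-distribʳ-⊗ x y n) ⟩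
  (x ⊗ y) ⊗ (x ^ n ⊗ y ^ n)  ≡⟨ solve 4 (λ x y X Y → (x :* y) :* (X :* Y) := (x :* X) :* (y :* Y)) refl x y (x ^ n) (y ^ n) ⟩
  (x ⊗ x ^ n) ⊗ (y ⊗ y ^ n)  ∎
  where
  open ≡-Reasoning
  open Q5-Solver

𝟙^n≡𝟙 : ∀ n → 𝟙 ^ n ≡ 𝟙
𝟙^n≡𝟙 zero    = refl
𝟙^n≡𝟙 (suc n) = trans (⊗-identityˡ (𝟙 ^ n)) (𝟙^n≡𝟙 n)

inv-inverseˡ : ∀ x → N x ≢ 0ℚ → inv x ⊗ x ≡ 𝟙
inv-inverseˡ (a +√5· b) N≢0 with a ℚ.* a ℚ.- five ℚ.* (b ℚ.* b) ℚ.≟ 0ℚ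
... | yes N≡0 = ⊥-elim (N≢0 N≡0)
... | no N≢0′ = cong₂ _+√5·_ (trans (re-eq (ℚ.1/ N′)) (ℚ.*-inverseʳ N′)) (ir-eq (ℚ.1/ N′))
  where
  N′ = a ℚ.* a ℚ.- five ℚ.* (b ℚ.* b)
  instance _ = ℚ.≢-nonZero N≢0′
  open ℚ-Solver
  re-eq : ∀ r → a ℚ.* r ℚ.* a ℚ.+ five ℚ.* (ℚ.- b ℚ.* r ℚ.* b) ≡ N′ ℚ.* r
  re-eq r = solve 4 (λ a b r v → a :* r :* a :+ v :* (:- b :* r :* b) := (a :* a :- v :* (b :* b)) :* r) refl a b r five
  ir-eq : ∀ r → a ℚ.* r ℚ.* b ℚ.+ ℚ.- b ℚ.* r ℚ.* a ≡ 0ℚ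
  ir-eq r = solve 3 (λ a b r → a :* r :* b :+ :- b :* r :* a := con 0ℚ) refl a b r

inv-unique : ∀ x y → x ⊗ y ≡ 𝟙 → inv x ≡ y
inv-unique x y xy≡𝟙 = begin
  inv x            ≡⟨ ⊗-identityʳ (inv x) ⟨
  inv x ⊗ 𝟙        ≡⟨ cong (inv x ⊗_) xy≡𝟙 ⟨
  inv x ⊗ (x ⊗ y)  ≡⟨ ⊗-assoc (inv x) x y ⟨
  (inv x ⊗ x) ⊗ y  ≡⟨ cong (_⊗ y) (inv-inverseˡ x N≢0) ⟩
  𝟙 ⊗ y            ≡⟨ ⊗-identityˡ y ⟩
  y                ∎
  where
  open ≡-Reasoning
  N≢0 : N x ≢ 0ℚ
  N≢0 N≡0 = ℚ.1≢0 (begin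
    1ℚ           ≡⟨ cong N xy≡𝟙 ⟨
    N (x ⊗ y)    ≡⟨ N-⊗ x y ⟩
    N x ℚ.* N y  ≡⟨ cong (ℚ._* N y) N≡0 ⟩
    0ℚ ℚ.* N y   ≡⟨ ℚ.*-zeroˡ (N y) ⟩
    0ℚ           ∎)

inv[φ^n]≡[⊝ψ]^n : ∀ n → inv (φ ^ n) ≡ (⊝ ψ) ^ n
inv[φ^n]≡[⊝ψ]^n n = inv-unique (φ ^ n) ((⊝ ψ) ^ n) (begin
  φ ^ n ⊗ (⊝ ψ) ^ n  ≡⟨ ^-distribʳ-⊗ φ (⊝ ψ) n ⟨
  (φ ⊗ ⊝ ψ) ^ n      ≡⟨⟩
  𝟙 ^ n              ≡⟨ 𝟙^n≡𝟙 n ⟩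
  𝟙                  ∎)
  where open ≡-Reasoning

A B : Q5
A = 𝟙 ⊖ c
B = c ⊘ (𝟚 ⊗ φ)

-- c = 2 / (3 + ψ²) is exactly the value for which the φⁿ-components of ỹ n cancel.
ỹ-closed-form : ∀ m → ỹ (suc m) ≡ A ⊕ B ⊗ ψ ^ m
ỹ-closed-form 0 = refl
ỹ-closed-form 1 = refl
ỹ-closed-form 2 = refl
ỹ-closed-form (suc (suc (suc m))) = solve 2 (λ X Y →
    let F₄ = (con φ :* (con φ :* X) :- con ψ :* (con ψ :* Y)) :* con (inv √5)
        F₂ = (X :- Y) :* con (inv √5)
    in ((con (fromℚ (1ℚ ℚ.+ 1ℚ ℚ.+ 1ℚ)) :* F₄ :+ F₂ :- con 𝟚) :* con c :- con 𝟚 :* F₄ :+ con 𝟚) :* con (inv 𝟚)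
       := con A :+ con B :* (con ψ :* Y))
  refl (φ ^ suc (suc m)) (ψ ^ suc (suc m))
  where open Q5-Solver

ỹ-+1 : ∀ n → ỹ (n + 1) ≡ ỹ (suc n)
ỹ-+1 n = cong ỹ (ℕ.+-comm n 1)

ỹ-step : ∀ k → 𝟚 ⊗ ỹ (suc k + 1) ≡ 𝟚 ⊗ ỹ (suc k) ⊖ c ⊗ ψ ^ k
ỹ-step k = begin
  𝟚 ⊗ ỹ (suc k + 1)                ≡⟨ cong (𝟚 ⊗_) (trans (ỹ-+1 (suc k)) (ỹ-closed-form (suc k))) ⟩
  𝟚 ⊗ (A ⊕ B ⊗ (ψ ⊗ ψ ^ k))        ≡⟨ solve 1 (λ Y → con 𝟚 :* (con A :+ con B :* (con ψ :* Y))
                                                   := con 𝟚 :* (con A :+ con B :* Y) :- con c :* Y) refl (ψ ^ k) ⟩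
  𝟚 ⊗ (A ⊕ B ⊗ ψ ^ k) ⊖ c ⊗ ψ ^ k  ≡⟨ cong (λ y → 𝟚 ⊗ y ⊖ c ⊗ ψ ^ k) (ỹ-closed-form k) ⟨
  𝟚 ⊗ ỹ (suc k) ⊖ c ⊗ ψ ^ k        ∎
  where
  open ≡-Reasoning
  open Q5-Solver

F-combination : ∀ k → (𝟚 ⊗ 𝟚 ⊗ c ⊖ 𝟚) ⊗ F (suc k) ⊖ c ⊗ F k ≡ ⊝ (c ⊗ ψ ^ suc k)
F-combination k = solve 2 (λ X Y →
    (con 𝟚 :* con 𝟚 :* con c :- con 𝟚) :* ((con φ :* X :- con ψ :* Y) :* con (inv √5)) :- con c :* ((X :- Y) :* con (inv √5))
    := :- (con c :* (con ψ :* Y)))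
  refl (φ ^ k) (ψ ^ k)
  where open Q5-Solver

2ỹ-difference : ∀ k → 𝟚 ⊗ ỹ (suc (suc k) + 1) ⊖ 𝟚 ⊗ ỹ (suc (suc k)) ≡ (𝟚 ⊗ 𝟚 ⊗ c ⊖ 𝟚) ⊗ F (suc k) ⊖ c ⊗ F k
2ỹ-difference k = begin
  𝟚 ⊗ ỹ (suc (suc k) + 1) ⊖ 𝟚 ⊗ ỹ (suc (suc k))    ≡⟨ cong (_⊖ T) (ỹ-step (suc k)) ⟩
  T ⊖ c ⊗ ψ ^ suc k ⊖ T                             ≡⟨ solve 2 (λ T Y → T :- Y :- T := :- Y) refl T (c ⊗ ψ ^ suc k) ⟩
  ⊝ (c ⊗ ψ ^ suc k)                                 ≡⟨ F-combination k ⟨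
  (𝟚 ⊗ 𝟚 ⊗ c ⊖ 𝟚) ⊗ F (suc k) ⊖ c ⊗ F k             ∎
  where
  open ≡-Reasoning
  open Q5-Solver
  T = 𝟚 ⊗ ỹ (suc (suc k))

x⊖cψ^k≡x⊕c[⊝𝟙]^[1+k]/φ^k : ∀ k x → x ⊖ c ⊗ ψ ^ k ≡ x ⊕ c ⊗ (⊝ 𝟙) ^ suc k ⊗ inv (φ ^ k)
x⊖cψ^k≡x⊕c[⊝𝟙]^[1+k]/φ^k k x = sym (begin
  x ⊕ c ⊗ (⊝ 𝟙 ⊗ (⊝ 𝟙) ^ k) ⊗ inv (φ ^ k)  ≡⟨ cong (λ z → x ⊕ c ⊗ (⊝ 𝟙 ⊗ (⊝ 𝟙) ^ k) ⊗ z) (inv[φ^n]≡[⊝ψ]^n k) ⟩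
  x ⊕ c ⊗ (⊝ 𝟙 ⊗ (⊝ 𝟙) ^ k) ⊗ (⊝ ψ) ^ k    ≡⟨ solve 3 (λ x E P → x :+ con c :* (con (⊝ 𝟙) :* E) :* P := x :- con c :* (E :* P))
                                                     refl x ((⊝ 𝟙) ^ k) ((⊝ ψ) ^ k) ⟩
  x ⊖ c ⊗ ((⊝ 𝟙) ^ k ⊗ (⊝ ψ) ^ k)           ≡⟨ cong (λ z → x ⊖ c ⊗ z) (^-distribʳ-⊗ (⊝ 𝟙) (⊝ ψ) k) ⟨
  x ⊖ c ⊗ (⊝ 𝟙 ⊗ ⊝ ψ) ^ k                   ≡⟨⟩
  x ⊖ c ⊗ ψ ^ k                             ∎)
  where
  open ≡-Reasoning
  open Q5-Solver

ỹ-recurrence : ∀ k → 𝟙 ⊖ ỹ (suc k) ⊖ ỹ (suc k + 1) ≡ c ⊖ ỹ (suc k + 2)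
ỹ-recurrence k = begin
  𝟙 ⊖ ỹ (suc k) ⊖ ỹ (suc k + 1)
    ≡⟨ cong₂ (λ u v → 𝟙 ⊖ u ⊖ v) (ỹ-closed-form k) (trans (ỹ-+1 (suc k)) (ỹ-closed-form (suc k))) ⟩
  𝟙 ⊖ (A ⊕ B ⊗ ψ ^ k) ⊖ (A ⊕ B ⊗ (ψ ⊗ ψ ^ k))
    ≡⟨ solve 1 (λ Y → con 𝟙 :- (con A :+ con B :* Y) :- (con A :+ con B :* (con ψ :* Y))
                      := con c :- (con A :+ con B :* (con ψ :* (con ψ :* Y)))) refl (ψ ^ k) ⟩
  c ⊖ (A ⊕ B ⊗ (ψ ⊗ (ψ ⊗ ψ ^ k)))
    ≡⟨ cong (c ⊖_) (trans (cong ỹ (ℕ.+-comm (suc k) 2)) (ỹ-closed-form (suc (suc k)))) ⟨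
  c ⊖ ỹ (suc k + 2)  ∎
  where
  open ≡-Reasoning
  open Q5-Solver

ỹ-odd : ∀ k → ỹ (2 * k + 1) ≡ A ⊕ B ⊗ (ψ ⊗ ψ) ^ k
ỹ-odd k = begin
  ỹ (2 * k + 1)        ≡⟨ ỹ-+1 (2 * k) ⟩
  ỹ (suc (2 * k))      ≡⟨ ỹ-closed-form (2 * k) ⟩
  A ⊕ B ⊗ ψ ^ (2 * k)  ≡⟨ cong (λ z → A ⊕ B ⊗ z) (^-double ψ k) ⟩
  A ⊕ B ⊗ (ψ ⊗ ψ) ^ k  ∎
  where open ≡-Reasoning

ỹ-even : ∀ k → ỹ (2 * suc k) ≡ A ⊕ B ⊗ ψ ⊗ (ψ ⊗ ψ) ^ k
ỹ-even k = begin
  ỹ (2 * suc k)              ≡⟨ cong ỹ (ℕ.*-suc 2 k) ⟩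
  ỹ (suc (suc (2 * k)))      ≡⟨ ỹ-closed-form (suc (2 * k)) ⟩
  A ⊕ B ⊗ (ψ ⊗ ψ ^ (2 * k))  ≡⟨ cong (λ z → A ⊕ B ⊗ (ψ ⊗ z)) (^-double ψ k) ⟩
  A ⊕ B ⊗ (ψ ⊗ (ψ ⊗ ψ) ^ k)  ≡⟨ cong (A ⊕_) (⊗-assoc B ψ ((ψ ⊗ ψ) ^ k)) ⟨
  A ⊕ B ⊗ ψ ⊗ (ψ ⊗ ψ) ^ k    ∎
  where open ≡-Reasoning

B-pos : Positive B
B-pos = from-yes (positive? B)

⊝ψ-pos : Positive (⊝ ψ)
⊝ψ-pos = from-yes (positive? (⊝ ψ))

ψ²-pos : Positive (ψ ⊗ ψ)
ψ²-pos = from-yes (positive? (ψ ⊗ ψ))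

ỹ-even-increasing : ∀ k → ỹ (2 * suc k) ≺ ỹ (2 * (suc k + 1))
ỹ-even-increasing k = Positive⇒Pos (subst Positive (sym difference) (pos⊗pos⇒pos B-pos (pos^n ψ²-pos (suc k))))
  where
  open ≡-Reasoning
  open Q5-Solver
  difference : ỹ (2 * (suc k + 1)) ⊖ ỹ (2 * suc k) ≡ B ⊗ (ψ ⊗ ψ) ^ suc k
  difference = begin
    ỹ (2 * (suc k + 1)) ⊖ ỹ (2 * suc k)
      ≡⟨ cong₂ _⊖_ (trans (cong (λ n → ỹ (2 * n)) (ℕ.+-comm (suc k) 1)) (ỹ-even (suc k))) (ỹ-even k) ⟩
    (A ⊕ B ⊗ ψ ⊗ ((ψ ⊗ ψ) ⊗ (ψ ⊗ ψ) ^ k)) ⊖ (A ⊕ B ⊗ ψ ⊗ (ψ ⊗ ψ) ^ k)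
      ≡⟨ solve 1 (λ T → (con A :+ con B :* con ψ :* (con (ψ ⊗ ψ) :* T)) :- (con A :+ con B :* con ψ :* T)
                        := con B :* (con (ψ ⊗ ψ) :* T)) refl ((ψ ⊗ ψ) ^ k) ⟩
    B ⊗ (ψ ⊗ ψ) ^ suc k  ∎

ỹ-odd-decreasing : ∀ k → ỹ (2 * (k + 1) + 1) ≺ ỹ (2 * k + 1)
ỹ-odd-decreasing k =
  Positive⇒Pos (subst Positive (sym difference) (pos⊗pos⇒pos (pos⊗pos⇒pos B-pos ⊝ψ-pos) (pos^n ψ²-pos k)))
  where
  open ≡-Reasoning
  open Q5-Solver
  difference : ỹ (2 * k + 1) ⊖ ỹ (2 * (k + 1) + 1) ≡ B ⊗ ⊝ ψ ⊗ (ψ ⊗ ψ) ^ k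
  difference = begin
    ỹ (2 * k + 1) ⊖ ỹ (2 * (k + 1) + 1)
      ≡⟨ cong₂ _⊖_ (ỹ-odd k) (trans (ỹ-odd (k + 1)) (cong (λ n → A ⊕ B ⊗ (ψ ⊗ ψ) ^ n) (ℕ.+-comm k 1))) ⟩
    (A ⊕ B ⊗ (ψ ⊗ ψ) ^ k) ⊖ (A ⊕ B ⊗ ((ψ ⊗ ψ) ⊗ (ψ ⊗ ψ) ^ k))
      ≡⟨ solve 1 (λ T → (con A :+ con B :* T) :- (con A :+ con B :* (con (ψ ⊗ ψ) :* T))
                        := con B :* con (⊝ ψ) :* T) refl ((ψ ⊗ ψ) ^ k) ⟩
    B ⊗ ⊝ ψ ⊗ (ψ ⊗ ψ) ^ k  ∎

ỹ-even≺ỹ-odd : ∀ k n → ỹ (2 * suc k) ≺ ỹ (2 * n + 1)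
ỹ-even≺ỹ-odd k n = Positive⇒Pos (subst Positive (sym difference)
  (pos⊕pos⇒pos (pos⊗pos⇒pos B-pos (pos^n ψ²-pos n)) (pos⊗pos⇒pos (pos⊗pos⇒pos B-pos ⊝ψ-pos) (pos^n ψ²-pos k))))
  where
  open ≡-Reasoning
  open Q5-Solver
  difference : ỹ (2 * n + 1) ⊖ ỹ (2 * suc k) ≡ B ⊗ (ψ ⊗ ψ) ^ n ⊕ B ⊗ ⊝ ψ ⊗ (ψ ⊗ ψ) ^ k
  difference = begin
    ỹ (2 * n + 1) ⊖ ỹ (2 * suc k)
      ≡⟨ cong₂ _⊖_ (ỹ-odd n) (ỹ-even k) ⟩
    (A ⊕ B ⊗ (ψ ⊗ ψ) ^ n) ⊖ (A ⊕ B ⊗ ψ ⊗ (ψ ⊗ ψ) ^ k)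
      ≡⟨ solve 2 (λ S T → (con A :+ con B :* S) :- (con A :+ con B :* con ψ :* T)
                          := con B :* S :+ con B :* con (⊝ ψ) :* T) refl ((ψ ⊗ ψ) ^ n) ((ψ ⊗ ψ) ^ k) ⟩
    B ⊗ (ψ ⊗ ψ) ^ n ⊕ B ⊗ ⊝ ψ ⊗ (ψ ⊗ ψ) ^ k  ∎

gap : Q5 → Q5 → Q5
gap u v = (𝟙 ⊕ c ⊘ 𝟚) ⊖ (u ⊕ 𝟚 ⊗ v)

-- gap (ỹ (m + 1)) (ỹ (m + 2)) = gap A A + M ψᵐ for a constant M, so two steps scale its distance
-- from the limit gap A A by ψ² ∈ (0, 1).
gap-recurrence : ∀ m → gap (ỹ (3 + m)) (ỹ (4 + m)) ≡ (𝟙 ⊖ ψ ⊗ ψ) ⊗ gap A A ⊕ (ψ ⊗ ψ) ⊗ gap (ỹ (1 + m)) (ỹ (2 + m))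
gap-recurrence m = begin
  gap (ỹ (3 + m)) (ỹ (4 + m))
    ≡⟨ cong₂ gap (ỹ-closed-form (2 + m)) (ỹ-closed-form (3 + m)) ⟩
  gap (A ⊕ B ⊗ (ψ ⊗ (ψ ⊗ Y))) (A ⊕ B ⊗ (ψ ⊗ (ψ ⊗ (ψ ⊗ Y))))
    ≡⟨ solve 1 (λ Y → G (con A :+ con B :* (con ψ :* (con ψ :* Y))) (con A :+ con B :* (con ψ :* (con ψ :* (con ψ :* Y))))
                      := (con 𝟙 :- con (ψ ⊗ ψ)) :* G (con A) (con A)
                         :+ con (ψ ⊗ ψ) :* G (con A :+ con B :* Y) (con A :+ con B :* (con ψ :* Y)))
               refl Y ⟩
  (𝟙 ⊖ ψ ⊗ ψ) ⊗ gap A A ⊕ (ψ ⊗ ψ) ⊗ gap (A ⊕ B ⊗ Y) (A ⊕ B ⊗ (ψ ⊗ Y))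
    ≡⟨ cong₂ (λ u v → (𝟙 ⊖ ψ ⊗ ψ) ⊗ gap A A ⊕ (ψ ⊗ ψ) ⊗ gap u v) (ỹ-closed-form m) (ỹ-closed-form (1 + m)) ⟨
  (𝟙 ⊖ ψ ⊗ ψ) ⊗ gap A A ⊕ (ψ ⊗ ψ) ⊗ gap (ỹ (1 + m)) (ỹ (2 + m))  ∎
  where
  open ≡-Reasoning
  open Q5-Solver
  Y = ψ ^ m
  G : ∀ {n} → Polynomial n → Polynomial n → Polynomial n
  G u v = (con 𝟙 :+ con (c ⊘ 𝟚)) :- (u :+ con 𝟚 :* v)

gap-pos : ∀ m → Positive (gap (ỹ (1 + m)) (ỹ (2 + m)))
gap-pos 0             = from-yes (positive? (gap (ỹ 1) (ỹ 2)))
gap-pos 1             = from-yes (positive? (gap (ỹ 2) (ỹ 3)))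
gap-pos (suc (suc m)) = subst Positive (sym (gap-recurrence m))
  (pos⊕pos⇒pos (pos⊗pos⇒pos (from-yes (positive? (𝟙 ⊖ ψ ⊗ ψ))) (from-yes (positive? (gap A A))))
               (pos⊗pos⇒pos ψ²-pos (gap-pos m)))

ỹ+2ỹ≺1+c/2 : ∀ m → ỹ (suc m) ⊕ 𝟚 ⊗ ỹ (suc m + 1) ≺ 𝟙 ⊕ c ⊘ 𝟚
ỹ+2ỹ≺1+c/2 m = Positive⇒Pos (subst (Positive ∘ gap (ỹ (suc m))) (sym (ỹ-+1 (suc m))) (gap-pos m))

lemma5 :
      (∀ (n : ℕ) → n ≥ 4 →
        𝟚 ⊗ ỹ (n + 1) ⊖ 𝟚 ⊗ ỹ n ≡ (𝟚 ⊗ 𝟚 ⊗ c ⊖ 𝟚) ⊗ F (n ∸ 1) ⊖ c ⊗ F (n ∸ 2))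
    × (∀ (n : ℕ) → n ≥ 4 →
        (𝟚 ⊗ ỹ (n + 1) ≡ 𝟚 ⊗ ỹ n ⊖ c ⊗ ψ ^ (n ∸ 1))
        × (𝟚 ⊗ ỹ n ⊖ c ⊗ ψ ^ (n ∸ 1) ≡ 𝟚 ⊗ ỹ n ⊕ c ⊗ (⊝ 𝟙) ^ n ⊗ inv (φ ^ (n ∸ 1))))
    × (∀ (k : ℕ) → k ≥ 1 → ỹ (2 * k) ≺ ỹ (2 * (k + 1)))
    × (∀ (k : ℕ) → k ≥ 1 → ỹ (2 * (k + 1) + 1) ≺ ỹ (2 * k + 1))
    × (∀ (k n : ℕ) → k ≥ 1 → n ≥ 1 → ỹ (2 * k) ≺ ỹ (2 * n + 1))
    × (∀ (n : ℕ) → n ≥ 1 → ỹ n ⊕ 𝟚 ⊗ ỹ (n + 1) ≺ 𝟙 ⊕ c ⊘ 𝟚)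
    × (∀ (n : ℕ) → n ≥ 1 → 𝟙 ⊖ ỹ n ⊖ ỹ (n + 1) ≡ c ⊖ ỹ (n + 2))
lemma5 =
    (λ { 0 () ; 1 (s≤s ()) ; (suc (suc k)) _ → 2ỹ-difference k })
  , (λ { 0 () ; (suc k) _ → ỹ-step k , x⊖cψ^k≡x⊕c[⊝𝟙]^[1+k]/φ^k k (𝟚 ⊗ ỹ (suc k)) })
  , (λ { 0 () ; (suc k) _ → ỹ-even-increasing k })
  , (λ k _ → ỹ-odd-decreasing k)
  , (λ { 0 _ () _ ; (suc k) n _ _ → ỹ-even≺ỹ-odd k n })
  , (λ { 0 () ; (suc m) _ → ỹ+2ỹ≺1+c/2 m })
  , (λ { 0 () ; (suc k) _ → ỹ-recurrence k })
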